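{- Let $(a_n)_{n\ge 0}$ be a sequence of real numbers with $a_0=1$, let $F(t)=1+\sum_{n\ge1}a_n\frac{t^n}{n!}$, and for every real $\alpha$ define polynomials $f_n^{(\alpha)}(x)$ by $\sum_{n\ge0}f_n^{(\alpha)}(x)\frac{t^n}{n!}=(F(t))^{\alpha}e^{xt}$. Let $\alpha$ be a real number and $n,m,p$ non-negative integers with $p\le\min(n,m)$. Then for all real $x,y$, $$\sum_{k=0}^{n}\binom{n}{k}\binom{m+k}{p}y^{n-k}f_{m-p+1+k}^{(\alpha)}(x)=\sum_{k=0}^{m}\binom{m}{k}\binom{n+k}{p}(-y)^{m-k}\Big(f_{n-p+1+k}^{(\alpha)}(x+y)-y\,f_{n-p+k}^{(\alpha)}(x+y)\Big).$$
   Context: Here $(F(t))^\alpha=\exp(\alpha\log F(t))$ as a formal power series (well defined since $F(0)=1$). -}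

module Defs where

open import Level using (Level)
open import Data.Nat using (ℕ; zero; suc; _∸_)
open import Data.Nat.Combinatorics using (_C_)
open import Data.Nat using (_!)
open import Algebra.Bundles using (CommutativeRing)

-- Formal power series over a commutative ring R in which every positive
-- integer k+1 is invertible (inverse given by inv k), i.e. a ℚ-algebra.
-- ℝ is such a ring; the stdlib has no reals.
module Series {c ℓ : Level} (R : CommutativeRing c ℓ)
              (inv : CommutativeRing.Carrier R → CommutativeRing.Carrier R) where
  open CommutativeRing R using (Carrier; _+_; _*_; -_; 0#; 1#)

  fromℕ : ℕ → Carrier
  fromℕ zero    = 0#
  fromℕ (suc n) = 1# + fromℕ n

  pow : Carrier → ℕ → Carrier
  pow x zero    = 1#
  pow x (suc n) = x * pow x n

  sumTo : ℕ → (ℕ → Carrier) → Carrier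
  sumTo zero    g = g zero
  sumTo (suc n) g = sumTo n g + g (suc n)

  recip : ℕ → Carrier
  recip k = inv (fromℕ (suc k))

  invFact : ℕ → Carrier
  invFact zero    = 1#
  invFact (suc n) = invFact n * recip n

  -- formal power series, given by ordinary coefficients: A n = [t^n] A
  PS : Set c
  PS = ℕ → Carrier

  oneS : PS
  oneS zero    = 1#
  oneS (suc n) = 0#

  mulS : PS → PS → PS
  mulS A B n = sumTo n (λ i → A i * B (n ∸ i))

  powS : PS → ℕ → PS
  powS H zero    = oneS
  powS H (suc k) = mulS H (powS H k)

  -- log of a series with constant term 1:  log F = Σ_{k≥1} (-1)^{k+1} (F-1)^k / k
  -- (the coefficient of t^n only receives contributions from k ≤ n)
  logS : PS → PS
  logS F n = sumTo n (λ j → pow (- 1#) j * recip j * powS F₁ (suc j) n)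
    where
      F₁ : PS
      F₁ zero    = 0#
      F₁ (suc m) = F (suc m)

  -- exp of a series with constant term 0:  exp G = Σ_{k≥0} G^k / k!
  -- (the coefficient of t^n only receives contributions from k ≤ n)
  expS : PS → PS
  expS G n = sumTo n (λ k → invFact k * powS G k n)

  Fser : (ℕ → Carrier) → PS
  Fser a zero    = 1#
  Fser a (suc n) = a (suc n) * invFact (suc n)

  Fpow : (ℕ → Carrier) → Carrier → PS
  Fpow a α n = expS (λ k → α * logS (Fser a) k) n

  expX : Carrier → PS
  expX x n = pow x n * invFact n

  f : (ℕ → Carrier) → Carrier → ℕ → Carrier → Carrier
  f a α n x = fromℕ (n !) * mulS (Fpow a α) (expX x) n

-- Expanding F(t)^α e^{xt} shows f_n(x) = Σ_k C(n,k) x^{n-k} f_k(0): the f_n form an Appell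
-- sequence, hence f_n(x + y) = Σ_k C(n,k) y^{n-k} f_k(x). Nothing else about F, α or a_0 is
-- used. Write E for the index shift of a sequence G and (E + y)^n G for the sequence
-- N ↦ Σ_k C(n,k) y^{n-k} G_{N+k}. With G_N = C(N,p) f_{N-p+1}(x), the addition law gives
-- ((E + y)^N G)_0 = H_N := C(N,p) (f_{N-p+1}(x+y) - y f_{N-p}(x+y)). The left-hand side is
-- ((E + y)^n E^m G)_0, and expanding E^m = ((E + y) - y)^m turns it into the right-hand side
-- Σ_k C(m,k) (-y)^{m-k} H_{n+k}.
{-# OPTIONS --safe #-}
module Submission where

open import Defs
open import Level using (Level)
open import Data.Nat using (ℕ; _≤_; _+_; _∸_)
open import Data.Nat.Combinatorics using (_C_)
open import Algebra.Bundles using (CommutativeRing)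

open import Data.Nat as ℕ using (zero; suc; _<_; _!; z≤n)
import Data.Nat.Properties as ℕₚ
open ℕₚ using (≤-refl; m≤n⇒m≤1+n; n<1+n; ≰⇒>; _≤?_; +-∸-comm; +-∸-assoc; _!*_!≢0)
open import Data.Nat.Combinatorics
  using (nCk≡n!/k![n-k]!; k![n∸k]!∣n!; k>n⇒nCk≡0; nCk+nC[k+1]≡[n+1]C[k+1])
open import Data.Nat.DivMod using (m/n*n≡m)
open import Relation.Binary.PropositionalEquality using (_≡_; cong)
import Relation.Binary.PropositionalEquality as ≡
open import Relation.Nullary using (yes; no)
import Algebra.Properties.Ring as RingProperties
import Algebra.Properties.Group as GroupProperties
import Algebra.Properties.CommutativeSemigroup as CommutativeSemigroupProperties

nCk*[k!*[n∸k]!]≡n! : ∀ {n k} → k ≤ n → (n C k) ℕ.* (k ! ℕ.* (n ∸ k) !) ≡ n !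
nCk*[k!*[n∸k]!]≡n! {n} {k} k≤n =
  ≡.trans (cong (λ q → q ℕ.* (k ! ℕ.* (n ∸ k) !)) (nCk≡n!/k![n-k]! {n} {k} k≤n))
          (m/n*n≡m {{k !* (n ∸ k) !≢0}} (k![n∸k]!∣n! k≤n))

m∸p+1+k≡1+[m+k∸p] : ∀ {m p} k → p ≤ m → m ∸ p + 1 + k ≡ suc (m + k ∸ p)
m∸p+1+k≡1+[m+k∸p] {m} {p} k p≤m =
  ≡.trans (ℕₚ.+-assoc (m ∸ p) 1 k)
          (≡.trans (ℕₚ.+-suc (m ∸ p) k) (cong suc (≡.sym (+-∸-comm k p≤m))))

module _ {c ℓ : Level} (R : CommutativeRing c ℓ)
         (inv : CommutativeRing.Carrier R → CommutativeRing.Carrier R) where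
  open CommutativeRing R renaming (_+_ to _⊕_)
  open Series R inv
  open RingProperties ring using (-‿distribˡ-*)
  open GroupProperties +-group using (//-rightDividesʳ)
  open CommutativeSemigroupProperties +-commutativeSemigroup
    using () renaming (interchange to ⊕-interchange; x∙yz≈y∙xz to x⊕[y⊕z]≈y⊕[x⊕z])
  open CommutativeSemigroupProperties *-commutativeSemigroup using (interchange; x∙yz≈y∙xz; xy∙z≈xz∙y)
  open import Relation.Binary.Reasoning.Setoid setoid

  sumTo-cong : ∀ n {g h : ℕ → Carrier} → (∀ k → g k ≈ h k) → sumTo n g ≈ sumTo n h
  sumTo-cong zero    g≈h = g≈h 0
  sumTo-cong (suc n) g≈h = +-cong (sumTo-cong n g≈h) (g≈h (suc n))

  sumTo-cong-≤ : ∀ n {g h : ℕ → Carrier} → (∀ {k} → k ≤ n → g k ≈ h k) → sumTo n g ≈ sumTo n h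
  sumTo-cong-≤ zero    g≈h = g≈h z≤n
  sumTo-cong-≤ (suc n) g≈h = +-cong (sumTo-cong-≤ n (λ k≤n → g≈h (m≤n⇒m≤1+n k≤n))) (g≈h ≤-refl)

  sumTo-⊕ : ∀ n g h → sumTo n (λ k → g k ⊕ h k) ≈ sumTo n g ⊕ sumTo n h
  sumTo-⊕ zero    g h = refl
  sumTo-⊕ (suc n) g h = trans (+-congʳ (sumTo-⊕ n g h)) (⊕-interchange _ _ _ _)

  *-distribˡ-sumTo : ∀ n x g → x * sumTo n g ≈ sumTo n (λ k → x * g k)
  *-distribˡ-sumTo zero    x g = refl
  *-distribˡ-sumTo (suc n) x g = trans (distribˡ x _ _) (+-congʳ (*-distribˡ-sumTo n x g))

  sumTo-suc : ∀ n g → sumTo (suc n) g ≈ g 0 ⊕ sumTo n (λ k → g (suc k))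
  sumTo-suc zero    g = refl
  sumTo-suc (suc n) g = trans (+-congʳ (sumTo-suc n g)) (+-assoc _ _ _)

  fromℕ-+ : ∀ m n → fromℕ (m + n) ≈ fromℕ m ⊕ fromℕ n
  fromℕ-+ zero    n = sym (+-identityˡ _)
  fromℕ-+ (suc m) n = trans (+-congˡ (fromℕ-+ m n)) (sym (+-assoc _ _ _))

  fromℕ-* : ∀ m n → fromℕ (m ℕ.* n) ≈ fromℕ m * fromℕ n
  fromℕ-* zero    n = sym (zeroˡ _)
  fromℕ-* (suc m) n = trans (fromℕ-+ n (m ℕ.* n))
    (trans (+-cong (sym (*-identityˡ _)) (fromℕ-* m n)) (sym (distribʳ _ _ _)))

  fromℕ-1 : fromℕ 1 ≈ 1#
  fromℕ-1 = +-identityʳ 1#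

  fromℕ-1* : ∀ x → fromℕ 1 * x ≈ x
  fromℕ-1* x = trans (*-congʳ fromℕ-1) (*-identityˡ x)

  fromℕ-pascal : ∀ n k → fromℕ (suc n C suc k) ≈ fromℕ (n C k) ⊕ fromℕ (n C suc k)
  fromℕ-pascal n k = trans (reflexive (cong fromℕ (≡.sym (nCk+nC[k+1]≡[n+1]C[k+1] n k)))) (fromℕ-+ (n C k) _)

  fromℕ-nCk*≈0 : ∀ {n k} → n < k → ∀ x → fromℕ (n C k) * x ≈ 0#
  fromℕ-nCk*≈0 n<k x = trans (*-congʳ (reflexive (cong fromℕ (k>n⇒nCk≡0 n<k)))) (zeroˡ x)

  -- When n ≤ q the two indices differ (truncated subtraction), but then C(n, q+1) = 0.
  fromℕ-nC[1+q]*-∸ : ∀ n q (h : ℕ → Carrier) →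
    fromℕ (n C suc q) * h (suc (n ∸ suc q)) ≈ fromℕ (n C suc q) * h (n ∸ q)
  fromℕ-nC[1+q]*-∸ n q h with suc q ≤? n
  ... | yes q<n = *-congˡ (reflexive (cong h (≡.sym (+-∸-assoc 1 q<n))))
  ... | no q≮n = trans (fromℕ-nCk*≈0 (≰⇒> q≮n) _) (sym (fromℕ-nCk*≈0 (≰⇒> q≮n) _))

  appell : (ℕ → Carrier) → ℕ → Carrier → Carrier
  appell a n z = sumTo n (λ k → fromℕ (n C k) * pow z (n ∸ k) * a k)

  appell-cong : ∀ {a b} n z → (∀ k → a k ≈ b k) → appell a n z ≈ appell b n z
  appell-cong n z a≈b = sumTo-cong n (λ k → *-congˡ (a≈b k))

  appell-⊕ : ∀ a b n z → appell (λ k → a k ⊕ b k) n z ≈ appell a n z ⊕ appell b n z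
  appell-⊕ a b n z = trans (sumTo-cong n (λ k → distribˡ _ _ _)) (sumTo-⊕ n _ _)

  appell-* : ∀ x a n z → appell (λ k → x * a k) n z ≈ x * appell a n z
  appell-* x a n z = trans (sumTo-cong n (λ k → x∙yz≈y∙xz _ x _)) (sym (*-distribˡ-sumTo n x _))

  appell-zero : ∀ a z → appell a 0 z ≈ a 0
  appell-zero a z = trans (*-congʳ (trans (*-identityʳ _) fromℕ-1)) (*-identityˡ _)

  *-appell : ∀ a n z → z * appell a n z ≈ sumTo (suc n) (λ k → fromℕ (n C k) * pow z (suc n ∸ k) * a k)
  *-appell a n z = begin
      z * appell a n z
    ≈⟨ *-distribˡ-sumTo n z _ ⟩
      sumTo n (λ k → z * (fromℕ (n C k) * pow z (n ∸ k) * a k))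
    ≈⟨ sumTo-cong-≤ n raise ⟨
      sumTo n σ
    ≈⟨ +-identityʳ _ ⟨
      sumTo n σ ⊕ 0#
    ≈⟨ +-congˡ (trans (*-congʳ (fromℕ-nCk*≈0 (n<1+n n) _)) (zeroˡ _)) ⟨
      sumTo (suc n) σ
    ∎
    where
    σ : ℕ → Carrier
    σ k = fromℕ (n C k) * pow z (suc n ∸ k) * a k
    raise : ∀ {k} → k ≤ n → σ k ≈ z * (fromℕ (n C k) * pow z (n ∸ k) * a k)
    raise {k} k≤n = begin
        fromℕ (n C k) * pow z (suc n ∸ k) * a k
      ≈⟨ *-congʳ (*-congˡ (reflexive (cong (pow z) (+-∸-assoc 1 k≤n)))) ⟩
        fromℕ (n C k) * (z * pow z (n ∸ k)) * a k
      ≈⟨ *-congʳ (x∙yz≈y∙xz _ _ _) ⟩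
        z * (fromℕ (n C k) * pow z (n ∸ k)) * a k
      ≈⟨ *-assoc _ _ _ ⟩
        z * (fromℕ (n C k) * pow z (n ∸ k) * a k)
      ∎

  appell-suc : ∀ a n z → appell a (suc n) z ≈ appell (λ k → a (suc k)) n z ⊕ z * appell a n z
  appell-suc a n z = begin
      appell a (suc n) z
    ≈⟨ sumTo-suc n τ ⟩
      τ 0 ⊕ sumTo n (λ k → τ (suc k))
    ≈⟨ +-congˡ (trans (sumTo-cong n pascal) (sumTo-⊕ n _ _)) ⟩
      τ 0 ⊕ (appell (λ k → a (suc k)) n z ⊕ sumTo n (λ k → σ (suc k)))
    ≈⟨ x⊕[y⊕z]≈y⊕[x⊕z] _ _ _ ⟩
      appell (λ k → a (suc k)) n z ⊕ (σ 0 ⊕ sumTo n (λ k → σ (suc k)))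
    ≈⟨ +-congˡ (sumTo-suc n σ) ⟨
      appell (λ k → a (suc k)) n z ⊕ sumTo (suc n) σ
    ≈⟨ +-congˡ (*-appell a n z) ⟨
      appell (λ k → a (suc k)) n z ⊕ z * appell a n z
    ∎
    where
    τ σ : ℕ → Carrier
    τ k = fromℕ (suc n C k) * pow z (suc n ∸ k) * a k
    σ k = fromℕ (n C k) * pow z (suc n ∸ k) * a k
    pascal : ∀ k → τ (suc k) ≈ fromℕ (n C k) * pow z (n ∸ k) * a (suc k) ⊕ σ (suc k)
    pascal k = trans (*-congʳ (trans (*-congʳ (fromℕ-pascal n k)) (distribʳ _ _ _))) (distribʳ _ _ _)

  appell-addition : ∀ a n x y → appell a n (x ⊕ y) ≈ appell (λ k → appell a k x) n y
  appell-addition a zero x y =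
    trans (appell-zero a (x ⊕ y)) (sym (trans (appell-zero (λ k → appell a k x) y) (appell-zero a x)))
  appell-addition a (suc n) x y = begin
      appell a (suc n) (x ⊕ y)
    ≈⟨ appell-suc a n (x ⊕ y) ⟩
      appell a′ n (x ⊕ y) ⊕ (x ⊕ y) * appell a n (x ⊕ y)
    ≈⟨ +-cong (appell-addition a′ n x y) (*-congˡ (appell-addition a n x y)) ⟩
      U ⊕ (x ⊕ y) * V
    ≈⟨ trans (+-congˡ (distribʳ V x y)) (sym (+-assoc _ _ _)) ⟩
      (U ⊕ x * V) ⊕ y * V
    ≈⟨ +-congʳ (trans (appell-⊕ _ _ n y) (+-congˡ (appell-* x _ n y))) ⟨
      appell (λ k → appell a′ k x ⊕ x * appell a k x) n y ⊕ y * V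
    ≈⟨ +-congʳ (appell-cong n y (λ k → appell-suc a k x)) ⟨
      appell (λ k → appell a (suc k) x) n y ⊕ y * V
    ≈⟨ appell-suc (λ k → appell a k x) n y ⟨
      appell (λ k → appell a k x) (suc n) y
    ∎
    where
    a′ : ℕ → Carrier
    a′ k = a (suc k)
    U V : Carrier
    U = appell (λ k → appell a′ k x) n y
    V = appell (λ k → appell a k x) n y

  -- The coefficients of the exponential generating function (t^p / p!) · Σ_j g j t^j / j!.
  lift : ℕ → (ℕ → Carrier) → ℕ → Carrier
  lift p g N = fromℕ (N C p) * g (N ∸ p)

  lift-suc : ∀ q g k → lift (suc q) g (suc k) ≈ lift q g k ⊕ lift (suc q) (λ j → g (suc j)) k
  lift-suc q g k = trans (*-congʳ (fromℕ-pascal k q))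
    (trans (distribʳ _ _ _) (+-congˡ (sym (fromℕ-nC[1+q]*-∸ k q g))))

  appell-lift : ∀ p g n y → appell (lift p g) n y ≈ fromℕ (n C p) * appell g (n ∸ p) y
  appell-lift zero g n y = trans (appell-cong n y (λ k → fromℕ-1* _)) (sym (fromℕ-1* _))
  appell-lift (suc q) g zero y =
    trans (appell-zero (lift (suc q) g) y) (trans (zeroˡ (g 0)) (sym (zeroˡ _)))
  appell-lift (suc q) g (suc n) y = begin
      appell (lift (suc q) g) (suc n) y
    ≈⟨ appell-suc _ n y ⟩
      appell (λ k → lift (suc q) g (suc k)) n y ⊕ y * appell (lift (suc q) g) n y
    ≈⟨ +-congʳ (trans (appell-cong n y (lift-suc q g)) (appell-⊕ _ _ n y)) ⟩
      (appell (lift q g) n y ⊕ appell (lift (suc q) g′) n y) ⊕ y * appell (lift (suc q) g) n y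
    ≈⟨ +-cong (+-cong (appell-lift q g n y) (appell-lift (suc q) g′ n y))
              (*-congˡ (appell-lift (suc q) g n y)) ⟩
      (Cq * Q ⊕ Cs * appell g′ (n ∸ suc q) y) ⊕ y * (Cs * appell g (n ∸ suc q) y)
    ≈⟨ trans (+-assoc _ _ _) (+-congˡ (+-congˡ (x∙yz≈y∙xz y Cs _))) ⟩
      Cq * Q ⊕ (Cs * appell g′ (n ∸ suc q) y ⊕ Cs * (y * appell g (n ∸ suc q) y))
    ≈⟨ +-congˡ (trans (sym (distribˡ Cs _ _)) (*-congˡ (sym (appell-suc g (n ∸ suc q) y)))) ⟩
      Cq * Q ⊕ Cs * appell g (suc (n ∸ suc q)) y
    ≈⟨ +-congˡ (fromℕ-nC[1+q]*-∸ n q (λ j → appell g j y)) ⟩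
      Cq * Q ⊕ Cs * Q
    ≈⟨ trans (sym (distribʳ Q Cq Cs)) (*-congʳ (sym (fromℕ-pascal n q))) ⟩
      fromℕ (suc n C suc q) * Q
    ∎
    where
    g′ : ℕ → Carrier
    g′ j = g (suc j)
    Cq Cs Q : Carrier
    Cq = fromℕ (n C q)
    Cs = fromℕ (n C suc q)
    Q = appell g (n ∸ q) y

  appell-shift-inversion : ∀ G H y → (∀ N → appell G N y ≈ H N) →
    ∀ m n → appell (λ k → G (m + k)) n y ≈ appell (λ k → H (n + k)) m (- y)
  appell-shift-inversion G H y appell≈H = go
    where
    A B : ℕ → ℕ → Carrier
    A m n = appell (λ k → G (m + k)) n y
    B m n = appell (λ k → H (n + k)) m (- y)

    A-suc : ∀ m n → A m (suc n) ≈ A (suc m) n ⊕ y * A m n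
    A-suc m n = trans (appell-suc _ n y)
      (+-congʳ (appell-cong n y (λ k → reflexive (cong G (ℕₚ.+-suc m k)))))

    B-suc : ∀ m n → B (suc m) n ≈ B m (suc n) ⊕ (- y) * B m n
    B-suc m n = trans (appell-suc _ m (- y))
      (+-congʳ (appell-cong m (- y) (λ k → reflexive (cong H (ℕₚ.+-suc n k)))))

    go : ∀ m n → A m n ≈ B m n
    go zero n = trans (appell≈H n)
      (sym (trans (appell-zero (λ k → H (n + k)) (- y)) (reflexive (cong H (ℕₚ.+-identityʳ n)))))
    go (suc m) n = begin
        A (suc m) n
      ≈⟨ //-rightDividesʳ _ _ ⟨
        (A (suc m) n ⊕ y * A m n) ⊕ (- (y * A m n))
      ≈⟨ +-congʳ (A-suc m n) ⟨
        A m (suc n) ⊕ (- (y * A m n))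
      ≈⟨ +-cong (go m (suc n)) (-‿cong (*-congˡ (go m n))) ⟩
        B m (suc n) ⊕ (- (y * B m n))
      ≈⟨ +-congˡ (-‿distribˡ-* y (B m n)) ⟩
        B m (suc n) ⊕ (- y) * B m n
      ≈⟨ B-suc m n ⟨
        B (suc m) n
      ∎

  module _ (s : ℕ → Carrier → Carrier)
           (s-addition : ∀ n x y → s n (x ⊕ y) ≈ appell (λ k → s k x) n y) where

    appellIdentity : (n m p : ℕ) → p ≤ n → p ≤ m → (x y : Carrier) →
      sumTo n (λ k → fromℕ (n C k) * fromℕ ((m + k) C p) * pow y (n ∸ k) * s (m ∸ p + 1 + k) x)
      ≈ sumTo m (λ k → fromℕ (m C k) * fromℕ ((n + k) C p) * pow (- y) (m ∸ k)
                       * (s (n ∸ p + 1 + k) (x ⊕ y) ⊕ (- (y * s (n ∸ p + k) (x ⊕ y)))))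
    appellIdentity n m p p≤n p≤m x y = begin
        _
      ≈⟨ sumTo-cong n (λ k → trans (xy∙z∙t≈xz∙yt _ _ _ _)
           (*-congˡ (*-congˡ (reflexive (cong (λ j → s j x) (m∸p+1+k≡1+[m+k∸p] k p≤m)))))) ⟩
        appell (λ k → lift p g (m + k)) n y
      ≈⟨ appell-shift-inversion (lift p g) (lift p h) y base m n ⟩
        appell (λ k → lift p h (n + k)) m (- y)
      ≈⟨ sumTo-cong m (λ k → trans (xy∙z∙t≈xz∙yt _ _ _ _) (*-congˡ (*-congˡ (h-index k)))) ⟨
        _
      ∎
      where
      g h : ℕ → Carrier
      g j = s (suc j) x
      h j = s (suc j) (x ⊕ y) ⊕ (- (y * s j (x ⊕ y)))

      xy∙z∙t≈xz∙yt : ∀ u v w t → u * v * w * t ≈ u * w * (v * t)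
      xy∙z∙t≈xz∙yt u v w t = trans (*-congʳ (xy∙z≈xz∙y u v w)) (*-assoc _ _ _)

      h≈appell : ∀ j → h j ≈ appell g j y
      h≈appell j = begin
          s (suc j) (x ⊕ y) ⊕ (- (y * s j (x ⊕ y)))
        ≈⟨ +-cong (trans (s-addition (suc j) x y) (appell-suc _ j y))
                  (-‿cong (*-congˡ (s-addition j x y))) ⟩
          (appell g j y ⊕ y * appell (λ k → s k x) j y) ⊕ (- (y * appell (λ k → s k x) j y))
        ≈⟨ //-rightDividesʳ _ _ ⟩
          appell g j y
        ∎

      base : ∀ N → appell (lift p g) N y ≈ lift p h N
      base N = trans (appell-lift p g N y) (*-congˡ (sym (h≈appell (N ∸ p))))

      h-index : ∀ k → s (n ∸ p + 1 + k) (x ⊕ y) ⊕ (- (y * s (n ∸ p + k) (x ⊕ y))) ≈ h (n + k ∸ p)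
      h-index k = reflexive (≡.cong₂ (λ i j → s i (x ⊕ y) ⊕ (- (y * s j (x ⊕ y))))
        (m∸p+1+k≡1+[m+k∸p] k p≤n) (≡.sym (+-∸-comm k p≤n)))

  module _ (recip-inverse : ∀ k → fromℕ (suc k) * recip k ≈ 1#) where

    fromℕ-!*invFact : ∀ k → fromℕ (k !) * invFact k ≈ 1#
    fromℕ-!*invFact zero    = trans (*-identityʳ _) fromℕ-1
    fromℕ-!*invFact (suc k) = begin
        fromℕ (suc k ℕ.* k !) * (invFact k * recip k)
      ≈⟨ *-cong (fromℕ-* (suc k) (k !)) (*-comm _ _) ⟩
        (fromℕ (suc k) * fromℕ (k !)) * (recip k * invFact k)
      ≈⟨ interchange _ _ _ _ ⟩
        (fromℕ (suc k) * recip k) * (fromℕ (k !) * invFact k)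
      ≈⟨ *-cong (recip-inverse k) (fromℕ-!*invFact k) ⟩
        1# * 1#
      ≈⟨ *-identityˡ 1# ⟩
        1#
      ∎

    fromℕ-n!*invFact[n∸i] : ∀ {n i} → i ≤ n →
      fromℕ (n !) * invFact (n ∸ i) ≈ fromℕ (n C i) * fromℕ (i !)
    fromℕ-n!*invFact[n∸i] {n} {i} i≤n = begin
        fromℕ (n !) * invFact (n ∸ i)
      ≈⟨ *-congʳ (reflexive (cong fromℕ (≡.sym (nCk*[k!*[n∸k]!]≡n! i≤n)))) ⟩
        fromℕ ((n C i) ℕ.* (i ! ℕ.* (n ∸ i) !)) * invFact (n ∸ i)
      ≈⟨ *-congʳ (trans (fromℕ-* (n C i) _) (*-congˡ (fromℕ-* (i !) _))) ⟩
        fromℕ (n C i) * (fromℕ (i !) * fromℕ ((n ∸ i) !)) * invFact (n ∸ i)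
      ≈⟨ trans (*-assoc _ _ _) (*-congˡ (*-assoc _ _ _)) ⟩
        fromℕ (n C i) * (fromℕ (i !) * (fromℕ ((n ∸ i) !) * invFact (n ∸ i)))
      ≈⟨ *-congˡ (trans (*-congˡ (fromℕ-!*invFact (n ∸ i))) (*-identityʳ _)) ⟩
        fromℕ (n C i) * fromℕ (i !)
      ∎

    f≈appell : ∀ a α n z → f a α n z ≈ appell (λ i → fromℕ (i !) * Fpow a α i) n z
    f≈appell a α n z = trans (*-distribˡ-sumTo n _ _) (sumTo-cong-≤ n term)
      where
      term : ∀ {i} → i ≤ n → fromℕ (n !) * (Fpow a α i * (pow z (n ∸ i) * invFact (n ∸ i)))
                           ≈ fromℕ (n C i) * pow z (n ∸ i) * (fromℕ (i !) * Fpow a α i)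
      term {i} i≤n = begin
          fromℕ (n !) * (Fpow a α i * (pow z (n ∸ i) * invFact (n ∸ i)))
        ≈⟨ *-congˡ (trans (*-comm _ _) (trans (*-congʳ (*-comm _ _)) (*-assoc _ _ _))) ⟩
          fromℕ (n !) * (invFact (n ∸ i) * (pow z (n ∸ i) * Fpow a α i))
        ≈⟨ *-assoc _ _ _ ⟨
          fromℕ (n !) * invFact (n ∸ i) * (pow z (n ∸ i) * Fpow a α i)
        ≈⟨ *-congʳ (fromℕ-n!*invFact[n∸i] i≤n) ⟩
          fromℕ (n C i) * fromℕ (i !) * (pow z (n ∸ i) * Fpow a α i)
        ≈⟨ interchange _ _ _ _ ⟩
          fromℕ (n C i) * pow z (n ∸ i) * (fromℕ (i !) * Fpow a α i)
        ∎

    f-addition : ∀ a α n x y → f a α n (x ⊕ y) ≈ appell (λ k → f a α k x) n y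
    f-addition a α n x y = begin
        f a α n (x ⊕ y)
      ≈⟨ f≈appell a α n (x ⊕ y) ⟩
        appell b n (x ⊕ y)
      ≈⟨ appell-addition b n x y ⟩
        appell (λ k → appell b k x) n y
      ≈⟨ appell-cong n y (λ k → f≈appell a α k x) ⟨
        appell (λ k → f a α k x) n y
      ∎
      where
      b : ℕ → Carrier
      b i = fromℕ (i !) * Fpow a α i

corollary5 : {c ℓ : Level} (R : CommutativeRing c ℓ) →
    let open CommutativeRing R renaming (_+_ to _⊕_) in
    (inv : Carrier → Carrier) →
    (let open Series R inv in (k : ℕ) → fromℕ (1 + k) * inv (fromℕ (1 + k)) ≈ 1#) →
    (a : ℕ → Carrier) → a 0 ≈ 1# →
    (α : Carrier) (n m p : ℕ) → p ≤ n → p ≤ m → (x y : Carrier) →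
    let open Series R inv in
    sumTo n (λ k → fromℕ (n C k) * fromℕ ((m + k) C p) * pow y (n ∸ k)
                     * f a α (m ∸ p + 1 + k) x)
    ≈ sumTo m (λ k → fromℕ (m C k) * fromℕ ((n + k) C p) * pow (- y) (m ∸ k)
                     * (f a α (n ∸ p + 1 + k) (x ⊕ y) ⊕ (- (y * f a α (n ∸ p + k) (x ⊕ y)))))
corollary5 R inv recip-inverse a _ α =
  appellIdentity R inv (Series.f R inv a α) (f-addition R inv recip-inverse a α)
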